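{- Let $r$ and $t$ be positive integers and let $P$ be the poset that is the disjoint sum of $t$ chains, each consisting of $r$ points (points in different chains are incomparable). Let $k$ be the positive integer with $(k-1)^r < t \le k^r$. Then $D(P) = k$.
   Context: All posets are finite. An automorphism of a poset $P=(X,\preceq)$ is a bijection $X\to X$ preserving $\preceq$ in both directions. A coloring of the points of $P$ is distinguishing if the only automorphism of $P$ that preserves colors is the identity. The distinguishing number $D(P)$ is the least integer $k$ such that $P$ has a distinguishing coloring using $k$ colors. -}

module Defs where

open import Level using (Level; _⊔_)
open import Data.Nat using (ℕ; _≤_)
open import Data.Fin using (Fin)
import Data.Fin as F
open import Data.Product using (_×_; Σ)
open import Relation.Binary.PropositionalEquality using (_≡_)
open import Function.Bundles using (_⇔_)
open import Function.Definitions using (Bijective)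

record Automorphism {a ℓ : Level} (X : Set a) (_≼_ : X → X → Set ℓ) : Set (a ⊔ ℓ) where
  field
    fun       : X → X
    bijective : Bijective _≡_ _≡_ fun
    preserves : ∀ x y → (x ≼ y) ⇔ (fun x ≼ fun y)

Distinguishing : {a ℓ : Level} (X : Set a) (_≼_ : X → X → Set ℓ) {k : ℕ} → (X → Fin k) → Set (a ⊔ ℓ)
Distinguishing X _≼_ c =
  (φ : Automorphism X _≼_) →
  (∀ x → c (Automorphism.fun φ x) ≡ c x) →
  ∀ x → Automorphism.fun φ x ≡ x

DistinguishingNumberIs : {a ℓ : Level} (X : Set a) (_≼_ : X → X → Set ℓ) → ℕ → Set (a ⊔ ℓ)
DistinguishingNumberIs X _≼_ k =
  Σ (X → Fin k) (Distinguishing X _≼_)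
  × (∀ m → Σ (X → Fin m) (Distinguishing X _≼_) → k ≤ m)

ChainPt : ℕ → ℕ → Set
ChainPt t r = Fin t × Fin r

_≼C_ : {t r : ℕ} → ChainPt t r → ChainPt t r → Set
(i Data.Product., a) ≼C (j Data.Product., b) = (i ≡ j) × (a F.≤ b)

module Submission where

-- A colouring c of the points assigns to every chain i its *word*
-- a ↦ c (i , a), a word of length r over k letters.
--
-- * Rigidity: an automorphism never changes the height of a point.  An
--   order-embedding of the chain sum maps the down-set of (i , a)
--   injectively into a down-set, so it can only raise heights; applying
--   this to an automorphism and to its inverse, heights are preserved.
--   Hence an automorphism just permutes the chains.
-- * Upper bound: if the chains get pairwise different words (possible as
--   t ≤ k ^ r), a colour-preserving automorphism fixes every chain, so the
--   colouring is distinguishing.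
-- * Lower bound: with m < k colours there are only m ^ r < t words, so by
--   pigeonhole two chains share a word; transposing these two chains is a
--   non-trivial colour-preserving automorphism.

open import Defs
open import Data.Nat using (ℕ; _≤_; _<_; _∸_; _^_)
import Data.Nat as ℕ
import Data.Nat.Properties as ℕP
open import Data.Fin as F using (Fin; zero; suc; toℕ; fromℕ<; inject≤; finToFun; funToFin)
import Data.Fin.Properties as FP
open import Data.Fin.Permutation using (Permutation; _⟨$⟩ʳ_; _⟨$⟩ˡ_; inverseˡ; inverseʳ; transpose)
import Data.Fin.Permutation.Components as PC
open import Data.Product using (_×_; _,_; proj₁; proj₂; Σ; ∃₂)
open import Data.Sum using (inj₁; inj₂)
open import Relation.Binary.PropositionalEquality
open import Relation.Nullary using (¬_; yes; no)
open import Relation.Nullary.Negation using (contradiction)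
open import Function using (_∘_)
open import Function.Bundles using (mk⇔; Equivalence)

downSetInjection⇒≤ : {r s : ℕ} (a : Fin r) (b : Fin s) (h : Fin r → Fin s) →
  (∀ c → c F.≤ a → h c F.≤ b) →
  (∀ c d → c F.≤ a → d F.≤ a → h c ≡ h d → c ≡ d) →
  a F.≤ b
downSetInjection⇒≤ a b h h-bounded h-injective =
  ℕ.s≤s⁻¹ (FP.injective⇒≤ {f = restricted} restricted-injective)
  where
  down : Fin (ℕ.suc (toℕ a)) → Fin _
  down c = inject≤ c (FP.toℕ<n a)

  down≤a : ∀ c → down c F.≤ a
  down≤a c = subst (_≤ toℕ a) (sym (FP.toℕ-inject≤ c _)) (FP.toℕ≤pred[n] c)

  restricted : Fin (ℕ.suc (toℕ a)) → Fin (ℕ.suc (toℕ b))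
  restricted c = fromℕ< (ℕ.s≤s (h-bounded (down c) (down≤a c)))

  restricted-injective : ∀ {c d} → restricted c ≡ restricted d → c ≡ d
  restricted-injective {c} {d} eq =
    FP.inject≤-injective _ _ c d
      (h-injective (down c) (down d) (down≤a c) (down≤a d)
        (FP.toℕ-injective (begin
          toℕ (h (down c))   ≡⟨ sym (FP.toℕ-fromℕ< _) ⟩
          toℕ (restricted c) ≡⟨ cong toℕ eq ⟩
          toℕ (restricted d) ≡⟨ FP.toℕ-fromℕ< _ ⟩
          toℕ (h (down d))   ∎)))
    where open ≡-Reasoning

module _ {t r : ℕ} where

  pointEq : {x y : ChainPt t r} → proj₁ x ≡ proj₁ y → proj₂ x ≡ proj₂ y → x ≡ y
  pointEq = cong₂ _,_

  -- An injective monotone self-map of the chain sum never lowers a point: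
  -- it maps the down-set of (i , a) injectively into the down-set of its image.
  embedding-raises : (g : ChainPt t r → ChainPt t r) →
    (∀ {x y} → g x ≡ g y → x ≡ y) →
    (∀ x y → x ≼C y → g x ≼C g y) →
    ∀ x → proj₂ x F.≤ proj₂ (g x)
  embedding-raises g g-injective g-monotone (i , a) =
    downSetInjection⇒≤ a (proj₂ (g (i , a))) (λ c → proj₂ (g (i , c)))
      (λ c c≤a → proj₂ (below c c≤a))
      (λ c d c≤a d≤a same → cong proj₂ (g-injective
         (pointEq (trans (proj₁ (below c c≤a)) (sym (proj₁ (below d d≤a)))) same)))
    where
    below : ∀ c → c F.≤ a → g (i , c) ≼C g (i , a)
    below c c≤a = g-monotone (i , c) (i , a) (refl , c≤a)

  module Rigidity (φ : Automorphism (ChainPt t r) _≼C_) where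
    open Automorphism φ renaming (fun to f)

    f-injective : ∀ {x y} → f x ≡ f y → x ≡ y
    f-injective = proj₁ bijective

    f⁻¹ : ChainPt t r → ChainPt t r
    f⁻¹ y = proj₁ (proj₂ bijective y)

    f∘f⁻¹ : ∀ y → f (f⁻¹ y) ≡ y
    f∘f⁻¹ y = proj₂ (proj₂ bijective y) refl

    f⁻¹∘f : ∀ x → f⁻¹ (f x) ≡ x
    f⁻¹∘f x = f-injective (f∘f⁻¹ (f x))

    f⁻¹-injective : ∀ {x y} → f⁻¹ x ≡ f⁻¹ y → x ≡ y
    f⁻¹-injective {x} {y} e = trans (sym (f∘f⁻¹ x)) (trans (cong f e) (f∘f⁻¹ y))

    f⁻¹-monotone : ∀ x y → x ≼C y → f⁻¹ x ≼C f⁻¹ y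
    f⁻¹-monotone x y x≼y =
      Equivalence.from (preserves (f⁻¹ x) (f⁻¹ y))
        (subst₂ _≼C_ (sym (f∘f⁻¹ x)) (sym (f∘f⁻¹ y)) x≼y)

    -- f raises every point and so does f⁻¹; hence f preserves heights.
    height-preserved : ∀ x → proj₂ (f x) ≡ proj₂ x
    height-preserved x = FP.≤-antisym lowered (raised x)
      where
      raised : ∀ y → proj₂ y F.≤ proj₂ (f y)
      raised = embedding-raises f f-injective (λ y z → Equivalence.to (preserves y z))

      lowered : proj₂ (f x) F.≤ proj₂ x
      lowered = subst (λ y → proj₂ (f x) F.≤ proj₂ y) (f⁻¹∘f x)
        (embedding-raises f⁻¹ f⁻¹-injective f⁻¹-monotone (f x))

    -- Comparable points stay in one chain, so the whole chain i is sent
    -- to the chain containing f (i , a).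
    same-chain : ∀ i a b → proj₁ (f (i , b)) ≡ proj₁ (f (i , a))
    same-chain i a b with FP.≤-total a b
    ... | inj₁ a≤b = sym (proj₁ (Equivalence.to (preserves (i , a) (i , b)) (refl , a≤b)))
    ... | inj₂ b≤a = proj₁ (Equivalence.to (preserves (i , b) (i , a)) (refl , b≤a))

    shape : ∀ i a b → f (i , b) ≡ (proj₁ (f (i , a)) , b)
    shape i a b = pointEq (same-chain i a b) (height-preserved (i , b))

  words-distinguishing : {k : ℕ} (w : Fin t → Fin r → Fin k) →
    (∀ i j → (∀ a → w i a ≡ w j a) → i ≡ j) →
    Distinguishing (ChainPt t r) _≼C_ (λ x → w (proj₁ x) (proj₂ x))
  words-distinguishing w w-injective φ colour-preserved (i , a) =
    trans (shape i a a) (cong (_, a) (w-injective _ _ same-word))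
    where
    open Rigidity φ
    same-word : ∀ b → w (proj₁ (Automorphism.fun φ (i , a))) b ≡ w i b
    same-word b = trans (cong (λ x → w (proj₁ x) (proj₂ x)) (sym (shape i a b)))
                        (colour-preserved (i , b))

  chainPermutation : Permutation t t → Automorphism (ChainPt t r) _≼C_
  chainPermutation π = record
    { fun       = permute
    ; bijective = permute-injective
                , (λ y → (π ⟨$⟩ˡ proj₁ y , proj₂ y) , λ { refl → cong (_, proj₂ y) (inverseʳ π) })
    ; preserves = λ x y → mk⇔ (λ x≼y → cong (π ⟨$⟩ʳ_) (proj₁ x≼y) , proj₂ x≼y)
                              (λ πx≼πy → π-injective (proj₁ πx≼πy) , proj₂ πx≼πy)
    }
    where
    permute : ChainPt t r → ChainPt t r
    permute (i , a) = (π ⟨$⟩ʳ i , a)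

    π-injective : ∀ {i j} → π ⟨$⟩ʳ i ≡ π ⟨$⟩ʳ j → i ≡ j
    π-injective {i} {j} e = trans (sym (inverseˡ π)) (trans (cong (π ⟨$⟩ˡ_) e) (inverseˡ π))

    permute-injective : ∀ {x y} → permute x ≡ permute y → x ≡ y
    permute-injective e = pointEq (π-injective (cong proj₁ e)) (cong proj₂ e)

transpose-invariant : ∀ {n} {A : Set} (w : Fin n → A) {i j : Fin n} →
  w i ≡ w j → ∀ k → w (PC.transpose i j k) ≡ w k
transpose-invariant w {i} {j} wi≡wj k with k FP.≟ i
... | yes refl = sym wi≡wj
... | no _ with k FP.≟ j
...   | yes refl = wi≡wj
...   | no _ = refl

transpose-moves : ∀ {n} (i j : Fin n) → PC.transpose i j i ≡ j
transpose-moves i j with i FP.≟ i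
... | yes _ = refl
... | no i≢i = contradiction refl i≢i

module _ {t r m : ℕ} where

  wordOf : (ChainPt t r → Fin m) → Fin t → Fin r → Fin m
  wordOf c i a = c (i , a)

  twins-notDistinguishing : (c : ChainPt t r → Fin m) (i j : Fin t) → i ≢ j →
    (∀ a → c (i , a) ≡ c (j , a)) → Fin r →
    ¬ Distinguishing (ChainPt t r) _≼C_ c
  twins-notDistinguishing c i j i≢j twins a distinguishing =
    i≢j (sym (trans (sym (transpose-moves i j)) (cong proj₁ swap-fixes-i)))
    where
    swap-fixes-i : (PC.transpose i j i , a) ≡ (i , a)
    swap-fixes-i = distinguishing (chainPermutation (transpose i j))
      (λ x → transpose-invariant (λ k → c (k , proj₂ x)) (twins (proj₂ x)) (proj₁ x))
      (i , a)

  twins-exist : m ^ r < t → (c : ChainPt t r → Fin m) →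
    ∃₂ λ i j → i ≢ j × (∀ a → c (i , a) ≡ c (j , a))
  twins-exist words<t c with FP.pigeonhole words<t (funToFin ∘ wordOf c)
  ... | i , j , i<j , same-code = i , j , FP.<⇒≢ i<j , same-word
    where
    same-word : ∀ a → c (i , a) ≡ c (j , a)
    same-word a = begin
      c (i , a)                          ≡⟨ sym (FP.finToFun-funToFin (wordOf c i) a) ⟩
      finToFun (funToFin (wordOf c i)) a ≡⟨ cong (λ code → finToFun code a) same-code ⟩
      finToFun (funToFin (wordOf c j)) a ≡⟨ FP.finToFun-funToFin (wordOf c j) a ⟩
      c (j , a)                          ∎
      where open ≡-Reasoning

  fewColours-notDistinguishing : m ^ r < t → Fin r → (c : ChainPt t r → Fin m) →
    ¬ Distinguishing (ChainPt t r) _≼C_ c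
  fewColours-notDistinguishing words<t a c with twins-exist words<t c
  ... | i , j , i≢j , twins = twins-notDistinguishing c i j i≢j twins a

funToFin-cong : ∀ {r k} (u v : Fin r → Fin k) → (∀ a → u a ≡ v a) → funToFin u ≡ funToFin v
funToFin-cong {ℕ.zero}  u v u≗v = refl
funToFin-cong {ℕ.suc r} u v u≗v =
  cong₂ F.combine (u≗v zero) (funToFin-cong (u ∘ suc) (v ∘ suc) (u≗v ∘ suc))

finToFun-injective : ∀ {k r} (x y : Fin (k ^ r)) →
  (∀ a → finToFun {k} {r} x a ≡ finToFun y a) → x ≡ y
finToFun-injective {k} {r} x y x≗y = begin
  x                              ≡⟨ sym (FP.funToFin-finToFin {r} {k} x) ⟩
  funToFin (finToFun {k} {r} x)  ≡⟨ funToFin-cong (finToFun {k} {r} x) (finToFun y) x≗y ⟩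
  funToFin (finToFun {k} {r} y)  ≡⟨ FP.funToFin-finToFin {r} {k} y ⟩
  y                              ∎
  where open ≡-Reasoning

proposition3p3 : (r t k : ℕ) → 1 ≤ r → 1 ≤ t → 1 ≤ k →
    (k ∸ 1) ^ r < t → t ≤ k ^ r →
    DistinguishingNumberIs (ChainPt t r) _≼C_ k
proposition3p3 r t k 1≤r _ _ few<t t≤words =
  (colouring , words-distinguishing word word-injective) , atLeast-k
  where
  word : Fin t → Fin r → Fin k
  word i = finToFun {k} {r} (inject≤ i t≤words)

  word-injective : ∀ i j → (∀ a → word i a ≡ word j a) → i ≡ j
  word-injective i j same =
    FP.inject≤-injective t≤words t≤words i j (finToFun-injective {k} {r} _ _ same)

  colouring : ChainPt t r → Fin k
  colouring x = word (proj₁ x) (proj₂ x)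

  -- With m < k colours there are at most (k ∸ 1) ^ r < t words.
  atLeast-k : ∀ m → Σ (ChainPt t r → Fin m) (Distinguishing (ChainPt t r) _≼C_) → k ≤ m
  atLeast-k m (c , distinguishing) = ℕP.≮⇒≥ λ m<k →
    fewColours-notDistinguishing
      (ℕP.≤-<-trans (ℕP.^-monoˡ-≤ r (ℕP.pred-mono-≤ m<k)) few<t)
      (fromℕ< 1≤r) c distinguishing
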